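{- For any rLTL formulas $\varphi,\psi$, any $\sigma\in\Sigma^\omega$ and any $\ell\in\mathbb N$: $V_1(\sigma_{\ell..},\varphi\,\dot{\mathcal R}\,\psi)=\min\{V_1(\sigma_{\ell..},\psi),\max\{V_1(\sigma_{\ell..},\varphi),V_1(\sigma_{\ell+1..},\varphi\,\dot{\mathcal R}\,\psi)\}\}$; $V_2(\sigma_{\ell..},\varphi\,\dot{\mathcal R}\,\psi)=\max\{V_1(\sigma_{\ell..},\varphi\,\dot{\mathcal R}\,\psi),V_2(\sigma_{\ell..},\varphi),V_2(\sigma_{\ell+1..},\varphi\,\dot{\mathcal R}\,\psi)\}$; $V_3(\sigma_{\ell..},\varphi\,\dot{\mathcal R}\,\psi)=\min\{V_4(\sigma_{\ell..},\varphi\,\dot{\mathcal R}\,\psi),\max\{V_3(\sigma_{\ell..},\varphi),V_3(\sigma_{\ell+1..},\varphi\,\dot{\mathcal R}\,\psi)\}\}$; $V_4(\sigma_{\ell..},\varphi\,\dot{\mathcal R}\,\psi)=\max\{V_4(\sigma_{\ell..},\psi),V_4(\sigma_{\ell..},\varphi),V_4(\sigma_{\ell+1..},\varphi\,\dot{\mathcal R}\,\psi)\}$; and for each $k\in\{1,2,3,4\}$: $V_k(\sigma_{\ell..},\varphi\,\dot{\mathcal U}\,\psi)=\max\{V_k(\sigma_{\ell..},\psi),\min\{V_k(\sigma_{\ell..},\varphi),V_k(\sigma_{\ell+1..},\varphi\,\dot{\mathcal U}\,\psi)\}\}$.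
   Context: Let $\mathcal P$ be a nonempty finite set of atomic propositions, $\Sigma=2^{\mathcal P}$; $\sigma(i)$ is the $i$-th symbol of $\sigma\in\Sigma^\omega$ and $\sigma_{i..}=\sigma(i)\sigma(i+1)\cdots$. $\mathbb B_4=\{0000,0001,0011,0111,1111\}\subseteq\{0,1\}^4$, totally ordered by $0000\prec0001\prec0011\prec0111\prec1111$; $\min,\max$ refer to this order (on $\{0,1\}$ they are the usual ones); $\overline{a}=0000$ if $a=1111$ and $1111$ otherwise; $a\rightarrow b=1111$ if $a\preceq b$ and $b$ otherwise; $\pi_k$ is the $k$-th coordinate projection. rLTL formulas: $p\in\mathcal P$, and $\neg\varphi$, $\varphi\lor\psi$, $\varphi\land\psi$, $\varphi\Rightarrow\psi$, $\dot{\bigcirc}\varphi$, $\boxdot\varphi$, $\dot{\Diamond}\varphi$, $\varphi\,\dot{\mathcal R}\,\psi$, $\varphi\,\dot{\mathcal U}\,\psi$. Valuation $V(\sigma,\varphi)\in\mathbb B_4$, $V_k=\pi_k\circ V$: $V(\sigma,p)=1111$ if $p\in\sigma(0)$, else $0000$; $\land$ is $\min$, $\lor$ is $\max$, $V(\sigma,\neg\varphi)=\overline{V(\sigma,\varphi)}$, $V(\sigma,\varphi\Rightarrow\psi)=V(\sigma,\varphi)\rightarrow V(\sigma,\psi)$; $V(\sigma,\dot{\bigcirc}\varphi)=V(\sigma_{1..},\varphi)$; $V(\sigma,\boxdot\varphi)=\big(\inf_{i\ge0}V_1(\sigma_{i..},\varphi),\sup_{j\ge0}\inf_{i\ge j}V_2(\sigma_{i..},\varphi),\inf_{j\ge0}\sup_{i\ge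 j}V_3(\sigma_{i..},\varphi),\sup_{i\ge0}V_4(\sigma_{i..},\varphi)\big)$; $V(\sigma,\dot{\Diamond}\varphi)=(\sup_{i\ge0}V_k(\sigma_{i..},\varphi))_{k=1..4}$. With $M_k(j)=\max\{V_k(\sigma_{j..},\psi),\sup_{0\le i<j}V_k(\sigma_{i..},\varphi)\}$: $V_1(\sigma,\varphi\,\dot{\mathcal R}\,\psi)=\inf_{j\ge0}M_1(j)$, $V_2(\sigma,\varphi\,\dot{\mathcal R}\,\psi)=\sup_{m\ge0}\inf_{j\ge m}M_2(j)$, $V_3(\sigma,\varphi\,\dot{\mathcal R}\,\psi)=\inf_{m\ge0}\sup_{j\ge m}M_3(j)$, $V_4(\sigma,\varphi\,\dot{\mathcal R}\,\psi)=\sup_{j\ge0}M_4(j)$. For each $k$: $V_k(\sigma,\varphi\,\dot{\mathcal U}\,\psi)=\sup_{j\ge0}\min\{V_k(\sigma_{j..},\psi),\inf_{0\le i<j}V_k(\sigma_{i..},\varphi)\}$. -}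

module Defs where

open import Data.Bool using (Bool; true; false; _∧_; _∨_; not; if_then_else_)
open import Data.Nat using (ℕ; zero; suc; _+_; _≤_; _<_; _≤ᵇ_)
open import Data.Fin using (Fin; zero; suc)
open import Data.Fin.Subset using (Subset)
open import Data.Vec using (lookup)
open import Data.Product using (Σ; ∃; _×_; _,_)
open import Function.Bundles using (_⇔_)
open import Relation.Binary.PropositionalEquality using (_≡_)

-- Propositions 𝓟 = Fin (suc n) (nonempty, finite); Σ = 2^𝓟 = Subset (suc n);
-- ω-words are functions ℕ → Σ.

Word : ℕ → Set
Word n = ℕ → Subset (suc n)

_↑_ : ∀ {n} → Word n → ℕ → Word n
(σ ↑ i) j = σ (i + j)

data B4 : Set where
  b0000 b0001 b0011 b0111 b1111 : B4

rank : B4 → ℕ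
rank b0000 = 0
rank b0001 = 1
rank b0011 = 2
rank b0111 = 3
rank b1111 = 4

π : Fin 4 → B4 → Bool
π zero b0000 = false
π zero b0001 = false
π zero b0011 = false
π zero b0111 = false
π zero b1111 = true
π (suc zero) b0000 = false
π (suc zero) b0001 = false
π (suc zero) b0011 = false
π (suc zero) b0111 = true
π (suc zero) b1111 = true
π (suc (suc zero)) b0000 = false
π (suc (suc zero)) b0001 = false
π (suc (suc zero)) b0011 = true
π (suc (suc zero)) b0111 = true
π (suc (suc zero)) b1111 = true
π (suc (suc (suc zero))) b0000 = false
π (suc (suc (suc zero))) b0001 = true
π (suc (suc (suc zero))) b0011 = true
π (suc (suc (suc zero))) b0111 = true
π (suc (suc (suc zero))) b1111 = true

π₁ π₂ π₃ π₄ : B4 → Bool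
π₁ = π zero
π₂ = π (suc zero)
π₃ = π (suc (suc zero))
π₄ = π (suc (suc (suc zero)))

minB maxB : B4 → B4 → B4
minB a b = if rank a ≤ᵇ rank b then a else b
maxB a b = if rank a ≤ᵇ rank b then b else a

negB : B4 → B4
negB b1111 = b0000
negB _     = b1111

impB : B4 → B4 → B4
impB a b = if rank a ≤ᵇ rank b then b1111 else b

data Formula (n : ℕ) : Set where
  atom  : Fin (suc n) → Formula n
  ¬̇_    : Formula n → Formula n
  _∨̇_ _∧̇_ _⇒̇_ : Formula n → Formula n → Formula n
  ○̇_ □̇_ ◇̇_ : Formula n → Formula n
  _Ṙ_ _U̇_ : Formula n → Formula n → Formula n

-- inf / sup / liminf / limsup of a bit sequence, characterised by the
-- value they take (a bit b is the inf iff b = 1 exactly when all are 1, …)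

IsInf IsSup IsSupInf IsInfSup : (ℕ → Bool) → Bool → Set
IsInf f b    = (b ≡ true) ⇔ (∀ i → f i ≡ true)
IsSup f b    = (b ≡ true) ⇔ (∃ λ i → f i ≡ true)
IsSupInf f b = (b ≡ true) ⇔ (∃ λ m → ∀ j → m ≤ j → f j ≡ true)
IsInfSup f b = (b ≡ true) ⇔ (∀ m → ∃ λ j → m ≤ j × f j ≡ true)

supBelow : ℕ → (ℕ → Bool) → Bool
supBelow zero    f = false
supBelow (suc j) f = supBelow j f ∨ f j

infBelow : ℕ → (ℕ → Bool) → Bool
infBelow zero    f = true
infBelow (suc j) f = infBelow j f ∧ f j

-- The valuation V(σ,φ) ∈ 𝔹₄, as a (functional) relation Val σ φ v.
-- For temporal operators, fs i = V(σ_{i..}, φ), gs i = V(σ_{i..}, ψ).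

data Val {n : ℕ} : Word n → Formula n → B4 → Set where
  v-atom : ∀ {σ p} → Val σ (atom p) (if lookup (σ 0) p then b1111 else b0000)
  v-not  : ∀ {σ φ a} → Val σ φ a → Val σ (¬̇ φ) (negB a)
  v-or   : ∀ {σ φ ψ a b} → Val σ φ a → Val σ ψ b → Val σ (φ ∨̇ ψ) (maxB a b)
  v-and  : ∀ {σ φ ψ a b} → Val σ φ a → Val σ ψ b → Val σ (φ ∧̇ ψ) (minB a b)
  v-imp  : ∀ {σ φ ψ a b} → Val σ φ a → Val σ ψ b → Val σ (φ ⇒̇ ψ) (impB a b)
  v-next : ∀ {σ φ a} → Val (σ ↑ 1) φ a → Val σ (○̇ φ) a
  v-box  : ∀ {σ φ v} (fs : ℕ → B4) → (∀ i → Val (σ ↑ i) φ (fs i)) →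
           IsInf    (λ i → π₁ (fs i)) (π₁ v) →
           IsSupInf (λ i → π₂ (fs i)) (π₂ v) →
           IsInfSup (λ i → π₃ (fs i)) (π₃ v) →
           IsSup    (λ i → π₄ (fs i)) (π₄ v) →
           Val σ (□̇ φ) v
  v-dia  : ∀ {σ φ v} (fs : ℕ → B4) → (∀ i → Val (σ ↑ i) φ (fs i)) →
           (∀ k → IsSup (λ i → π k (fs i)) (π k v)) →
           Val σ (◇̇ φ) v
  v-rel  : ∀ {σ φ ψ v} (fs gs : ℕ → B4) →
           (∀ i → Val (σ ↑ i) φ (fs i)) → (∀ i → Val (σ ↑ i) ψ (gs i)) →
           let M : Fin 4 → ℕ → Bool
               M k j = π k (gs j) ∨ supBelow j (λ i → π k (fs i))
           in
           IsInf    (M zero) (π₁ v) →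
           IsSupInf (M (suc zero)) (π₂ v) →
           IsInfSup (M (suc (suc zero))) (π₃ v) →
           IsSup    (M (suc (suc (suc zero)))) (π₄ v) →
           Val σ (φ Ṙ ψ) v
  v-until : ∀ {σ φ ψ v} (fs gs : ℕ → B4) →
           (∀ i → Val (σ ↑ i) φ (fs i)) → (∀ i → Val (σ ↑ i) ψ (gs i)) →
           (∀ k → IsSup (λ j → π k (gs j) ∧ infBelow j (λ i → π k (fs i))) (π k v)) →
           Val σ (φ U̇ ψ) v

module Submission where

-- The k-th bit of V(σ, φ Ṙ ψ) is an inf, sup-inf, inf-sup or sup of the bit
-- sequence  M k j = ψ_k(j) ∨ ⋁_{i<j} φ_k(i),  and the k-th bit of φ U̇ ψ is
-- the sup of  ψ_k(j) ∧ ⋀_{i<j} φ_k(i)  (φ_k(i), ψ_k(i) being the k-th bits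
-- at the suffix σ_{i..}).  Passing from σ_{ℓ..} to σ_{ℓ+1..} shifts these
-- sequences by one: M k (j+1) = φ_k(0) ∨ M′ k j, with M′ the sequence of
-- σ_{ℓ+1..} (and likewise with ∧ for until).
-- The extra disjunct π₁ r and conjunct π₄ r in bits 2 and 3 only reflect that
-- the bits of every element of 𝔹₄ increase: π₁ ≤ π₂ ≤ π₃ ≤ π₄.

open import Defs
open import Data.Nat using (ℕ; zero; suc; _+_; _≤_; s≤s)
open import Data.Nat.Properties using (+-suc; ≤-refl; m≤n⇒m≤1+n)
open import Data.Fin using (Fin; zero; suc)
open import Data.Bool using (Bool; true; false; _∧_; _∨_; if_then_else_)
open import Data.Bool.Properties
  using (∨-assoc; ∧-assoc; ∨-identityʳ; ∧-identityʳ; ∨-commutativeMonoid; ∧-commutativeMonoid)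
open import Data.Vec using (lookup)
open import Data.Product using (_×_; _,_; ∃)
open import Data.Sum using (_⊎_; inj₁; inj₂)
open import Function.Bundles using (_⇔_; mk⇔; Equivalence)
open import Algebra.Bundles using (CommutativeMonoid)
open import Relation.Binary.PropositionalEquality
  using (_≡_; refl; sym; trans; cong; cong₂; subst₂; module ≡-Reasoning)
import Algebra.Properties.CommutativeSemigroup as CommSemigroupProps

open Equivalence using (to; from)
open ≡-Reasoning

module ∨-Props = CommSemigroupProps (CommutativeMonoid.commutativeSemigroup ∨-commutativeMonoid)
module ∧-Props = CommSemigroupProps (CommutativeMonoid.commutativeSemigroup ∧-commutativeMonoid)

∨-true-split : ∀ x y → x ∨ y ≡ true → x ≡ true ⊎ y ≡ true
∨-true-split true  _ _ = inj₁ refl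
∨-true-split false _ p = inj₂ p

∨-trueˡ : ∀ {x} y → x ≡ true → x ∨ y ≡ true
∨-trueˡ _ refl = refl

∨-trueʳ : ∀ x {y} → y ≡ true → x ∨ y ≡ true
∨-trueʳ true  _ = refl
∨-trueʳ false p = p

∧-true-split : ∀ x y → x ∧ y ≡ true → x ≡ true × y ≡ true
∧-true-split true _ p = refl , p

∧-true-intro : ∀ {x y} → x ≡ true → y ≡ true → x ∧ y ≡ true
∧-true-intro refl q = q

bool-ext : ∀ x y → (x ≡ true → y ≡ true) → (y ≡ true → x ≡ true) → x ≡ y
bool-ext true  true  _ _ = refl
bool-ext true  false f _ = sym (f refl)
bool-ext false true  _ g = g refl
bool-ext false false _ _ = refl

∨-absorb-below : ∀ x y → (x ≡ true → y ≡ true) → y ≡ x ∨ y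
∨-absorb-below true  _ f = f refl
∨-absorb-below false _ _ = refl

∧-absorb-above : ∀ x y → (x ≡ true → y ≡ true) → x ≡ y ∧ x
∧-absorb-above true  _ f = sym (cong (_∧ true) (f refl))
∧-absorb-above false true  _ = refl
∧-absorb-above false false _ = refl

bit-unique : ∀ {P Q : Set} {b b′ : Bool} →
  (b ≡ true) ⇔ P → (b′ ≡ true) ⇔ Q → (P → Q) → (Q → P) → b ≡ b′
bit-unique {b = b} {b′} e e′ f g =
  bool-ext b b′ (λ p → from e′ (f (to e p))) (λ q → from e (g (to e′ q)))

inf-unique : ∀ {f f′ b b′} → (∀ i → f i ≡ f′ i) → IsInf f b → IsInf f′ b′ → b ≡ b′
inf-unique e h h′ =
  bit-unique h h′ (λ a i → trans (sym (e i)) (a i)) (λ a i → trans (e i) (a i))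

sup-unique : ∀ {f f′ b b′} → (∀ i → f i ≡ f′ i) → IsSup f b → IsSup f′ b′ → b ≡ b′
sup-unique e h h′ = bit-unique h h′
  (λ { (i , a) → i , trans (sym (e i)) a }) (λ { (i , a) → i , trans (e i) a })

supInf-unique : ∀ {f f′ b b′} → (∀ i → f i ≡ f′ i) →
  IsSupInf f b → IsSupInf f′ b′ → b ≡ b′
supInf-unique e h h′ = bit-unique h h′
  (λ { (m , a) → m , λ j m≤j → trans (sym (e j)) (a j m≤j) })
  (λ { (m , a) → m , λ j m≤j → trans (e j) (a j m≤j) })

infSup-unique : ∀ {f f′ b b′} → (∀ i → f i ≡ f′ i) →
  IsInfSup f b → IsInfSup f′ b′ → b ≡ b′
infSup-unique e h h′ = bit-unique h h′
  (λ a m → let (j , m≤j , t) = a m in j , m≤j , trans (sym (e j)) t)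
  (λ a m → let (j , m≤j , t) = a m in j , m≤j , trans (e j) t)

supBelow-cong : ∀ {f g : ℕ → Bool} → (∀ i → f i ≡ g i) →
  ∀ j → supBelow j f ≡ supBelow j g
supBelow-cong e zero    = refl
supBelow-cong e (suc j) = cong₂ _∨_ (supBelow-cong e j) (e j)

infBelow-cong : ∀ {f g : ℕ → Bool} → (∀ i → f i ≡ g i) →
  ∀ j → infBelow j f ≡ infBelow j g
infBelow-cong e zero    = refl
infBelow-cong e (suc j) = cong₂ _∧_ (infBelow-cong e j) (e j)

fromBits : Bool → Bool → Bool → Bool → B4
fromBits true  _     _     _     = b1111
fromBits false true  _     _     = b0111
fromBits false false true  _     = b0011
fromBits false false false true  = b0001
fromBits false false false false = b0000

fromBits-bits : ∀ a → fromBits (π₁ a) (π₂ a) (π₃ a) (π₄ a) ≡ a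
fromBits-bits b0000 = refl
fromBits-bits b0001 = refl
fromBits-bits b0011 = refl
fromBits-bits b0111 = refl
fromBits-bits b1111 = refl

B4-ext : ∀ {a b} → π₁ a ≡ π₁ b → π₂ a ≡ π₂ b → π₃ a ≡ π₃ b → π₄ a ≡ π₄ b → a ≡ b
B4-ext {a} {b} e₁ e₂ e₃ e₄ = begin
  a                                   ≡⟨ sym (fromBits-bits a) ⟩
  fromBits (π₁ a) (π₂ a) (π₃ a) (π₄ a) ≡⟨ cong₂ (λ f x → f x)
                                          (cong₂ (λ f x → f x) (cong₂ fromBits e₁ e₂) e₃) e₄ ⟩
  fromBits (π₁ b) (π₂ b) (π₃ b) (π₄ b) ≡⟨ fromBits-bits b ⟩
  b                                   ∎

π₁⇒π₂ : ∀ x → π₁ x ≡ true → π₂ x ≡ true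
π₁⇒π₂ b1111 _ = refl

π₃⇒π₄ : ∀ x → π₃ x ≡ true → π₄ x ≡ true
π₃⇒π₄ b0011 _ = refl
π₃⇒π₄ b0111 _ = refl
π₃⇒π₄ b1111 _ = refl

_≈_ : ∀ {n} → Word n → Word n → Set
σ ≈ τ = ∀ j → σ j ≡ τ j

Val-functional : ∀ {n} {σ τ : Word n} {φ a b} → Val σ φ a → Val τ φ b → σ ≈ τ → a ≡ b
Val-functional (v-atom {p = p}) v-atom e =
  cong (λ s → if lookup s p then b1111 else b0000) (e 0)
Val-functional (v-not v) (v-not w) e = cong negB (Val-functional v w e)
Val-functional (v-or v v′) (v-or w w′) e =
  cong₂ maxB (Val-functional v w e) (Val-functional v′ w′ e)
Val-functional (v-and v v′) (v-and w w′) e =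
  cong₂ minB (Val-functional v w e) (Val-functional v′ w′ e)
Val-functional (v-imp v v′) (v-imp w w′) e =
  cong₂ impB (Val-functional v w e) (Val-functional v′ w′ e)
Val-functional (v-next v) (v-next w) e = Val-functional v w (λ j → e (1 + j))
Val-functional (v-box fs h i₁ i₂ i₃ i₄) (v-box fs′ h′ j₁ j₂ j₃ j₄) e =
  B4-ext (inf-unique (bit zero) i₁ j₁) (supInf-unique (bit (suc zero)) i₂ j₂)
         (infSup-unique (bit (suc (suc zero))) i₃ j₃) (sup-unique (bit (suc (suc (suc zero)))) i₄ j₄)
  where
  bit : ∀ k i → π k (fs i) ≡ π k (fs′ i)
  bit k i = cong (π k) (Val-functional (h i) (h′ i) (λ j → e (i + j)))
Val-functional {a = a} {b} (v-dia fs h s) (v-dia fs′ h′ s′) e =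
  B4-ext (agg zero) (agg (suc zero)) (agg (suc (suc zero))) (agg (suc (suc (suc zero))))
  where
  agg : ∀ k → π k a ≡ π k b
  agg k = sup-unique (λ i → cong (π k) (Val-functional (h i) (h′ i) (λ j → e (i + j)))) (s k) (s′ k)
Val-functional (v-rel fs gs hf hg i₁ i₂ i₃ i₄) (v-rel fs′ gs′ hf′ hg′ j₁ j₂ j₃ j₄) e =
  B4-ext (inf-unique (seq zero) i₁ j₁) (supInf-unique (seq (suc zero)) i₂ j₂)
         (infSup-unique (seq (suc (suc zero))) i₃ j₃) (sup-unique (seq (suc (suc (suc zero)))) i₄ j₄)
  where
  bitφ : ∀ k i → π k (fs i) ≡ π k (fs′ i)
  bitψ : ∀ k i → π k (gs i) ≡ π k (gs′ i)
  bitφ k i = cong (π k) (Val-functional (hf i) (hf′ i) (λ j → e (i + j)))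
  bitψ k i = cong (π k) (Val-functional (hg i) (hg′ i) (λ j → e (i + j)))
  seq : ∀ k j → (π k (gs j) ∨ supBelow j (λ i → π k (fs i)))
              ≡ (π k (gs′ j) ∨ supBelow j (λ i → π k (fs′ i)))
  seq k j = cong₂ _∨_ (bitψ k j) (supBelow-cong (bitφ k) j)
Val-functional {a = a} {b} (v-until fs gs hf hg s) (v-until fs′ gs′ hf′ hg′ s′) e =
  B4-ext (agg zero) (agg (suc zero)) (agg (suc (suc zero))) (agg (suc (suc (suc zero))))
  where
  bitφ : ∀ k i → π k (fs i) ≡ π k (fs′ i)
  bitψ : ∀ k i → π k (gs i) ≡ π k (gs′ i)
  bitφ k i = cong (π k) (Val-functional (hf i) (hf′ i) (λ j → e (i + j)))
  bitψ k i = cong (π k) (Val-functional (hg i) (hg′ i) (λ j → e (i + j)))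
  agg : ∀ k → π k a ≡ π k b
  agg k = sup-unique (λ j → cong₂ _∧_ (bitψ k j) (infBelow-cong (bitφ k) j)) (s k) (s′ k)

suffixes-head : ∀ {n} (σ : Word n) {χ : Formula n} {fs : ℕ → B4} {a : B4} →
  (∀ i → Val (σ ↑ i) χ (fs i)) → Val σ χ a → fs 0 ≡ a
suffixes-head _ h v = Val-functional (h 0) v (λ _ → refl)

suffixes-tail : ∀ {n} (σ τ : Word n) → (σ ↑ 1) ≈ τ → ∀ {χ : Formula n} {fs fs′ : ℕ → B4} →
  (∀ i → Val (σ ↑ i) χ (fs i)) → (∀ i → Val (τ ↑ i) χ (fs′ i)) →
  ∀ i → fs (suc i) ≡ fs′ i
suffixes-tail _ _ e h h′ i = Val-functional (h (suc i)) (h′ i) (λ j → e (i + j))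

↑-suc : ∀ {n} (σ : Word n) ℓ → ((σ ↑ ℓ) ↑ 1) ≈ (σ ↑ suc ℓ)
↑-suc σ ℓ j = cong σ (+-suc ℓ j)

module _ {m m′ : ℕ → Bool} (tail : ∀ j → m (suc j) ≡ m′ j) where

  inf-cons : ∀ {r r′} → IsInf m r → IsInf m′ r′ → r ≡ m 0 ∧ r′
  inf-cons {r} {r′} h h′ = bool-ext r (m 0 ∧ r′) down up
    where
    down : r ≡ true → m 0 ∧ r′ ≡ true
    down p = ∧-true-intro (to h p 0) (from h′ (λ j → trans (sym (tail j)) (to h p (suc j))))
    up : m 0 ∧ r′ ≡ true → r ≡ true
    up q with ∧-true-split (m 0) r′ q
    ... | m₀ , t = from h λ { zero → m₀ ; (suc j) → trans (tail j) (to h′ t j) }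

  sup-cons : ∀ {r r′} → IsSup m r → IsSup m′ r′ → r ≡ m 0 ∨ r′
  sup-cons {r} {r′} h h′ = bool-ext r (m 0 ∨ r′) down up
    where
    down : r ≡ true → m 0 ∨ r′ ≡ true
    down p with to h p
    ... | zero  , t = ∨-trueˡ r′ t
    ... | suc j , t = ∨-trueʳ (m 0) (from h′ (j , trans (sym (tail j)) t))
    up : m 0 ∨ r′ ≡ true → r ≡ true
    up q with ∨-true-split (m 0) r′ q
    ... | inj₁ t = from h (0 , t)
    ... | inj₂ t with to h′ t
    ...   | j , w = from h (suc j , trans (tail j) w)

  supInf-cons : ∀ {r r′} → IsSupInf m r → IsSupInf m′ r′ → r ≡ r′
  supInf-cons h h′ = bit-unique h h′
    (λ { (k , a) → k , λ j k≤j → trans (sym (tail j)) (a (suc j) (m≤n⇒m≤1+n k≤j)) })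
    (λ { (k , a) → suc k , λ { zero () ; (suc j) (s≤s k≤j) → trans (tail j) (a j k≤j) } })

  infSup-cons : ∀ {r r′} → IsInfSup m r → IsInfSup m′ r′ → r ≡ r′
  infSup-cons h h′ = bit-unique h h′
    (λ a k → lower (a (suc k)))
    (λ a k → let (j , k≤j , t) = a k in suc j , m≤n⇒m≤1+n k≤j , trans (tail j) t)
    where
    lower : ∀ {k} → ∃ (λ j → suc k ≤ j × m j ≡ true) → ∃ (λ j → k ≤ j × m′ j ≡ true)
    lower (zero  , ()      , _)
    lower (suc j , s≤s k≤j , t) = j , k≤j , trans (sym (tail j)) t

inf-∨ˡ : ∀ c {m r} → IsInf m r → IsInf (λ j → c ∨ m j) (c ∨ r)
inf-∨ˡ true  _ = mk⇔ (λ _ _ → refl) (λ _ → refl)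
inf-∨ˡ false h = h

sup-∨ˡ : ∀ c {m r} → IsSup m r → IsSup (λ j → c ∨ m j) (c ∨ r)
sup-∨ˡ true  _ = mk⇔ (λ _ → 0 , refl) (λ _ → refl)
sup-∨ˡ false h = h

supInf-∨ˡ : ∀ c {m r} → IsSupInf m r → IsSupInf (λ j → c ∨ m j) (c ∨ r)
supInf-∨ˡ true  _ = mk⇔ (λ _ → 0 , λ _ _ → refl) (λ _ → refl)
supInf-∨ˡ false h = h

infSup-∨ˡ : ∀ c {m r} → IsInfSup m r → IsInfSup (λ j → c ∨ m j) (c ∨ r)
infSup-∨ˡ true  _ = mk⇔ (λ _ k → k , ≤-refl , refl) (λ _ → refl)
infSup-∨ˡ false h = h

sup-∧ˡ : ∀ c {m r} → IsSup m r → IsSup (λ j → c ∧ m j) (c ∧ r)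
sup-∧ˡ true  h = h
sup-∧ˡ false _ = mk⇔ (λ ()) (λ { (_ , ()) })

releaseSeq untilSeq : Fin 4 → (ℕ → B4) → (ℕ → B4) → ℕ → Bool
releaseSeq k fs gs j = π k (gs j) ∨ supBelow j (λ i → π k (fs i))
untilSeq   k fs gs j = π k (gs j) ∧ infBelow j (λ i → π k (fs i))

-- The aggregates defining the bits of a release / until valuation
-- (exactly the side conditions of the constructors v-rel and v-until).
IsRelease IsUntil : (ℕ → B4) → (ℕ → B4) → B4 → Set
IsRelease fs gs v =
    IsInf    (releaseSeq zero fs gs) (π₁ v)
  × IsSupInf (releaseSeq (suc zero) fs gs) (π₂ v)
  × IsInfSup (releaseSeq (suc (suc zero)) fs gs) (π₃ v)
  × IsSup    (releaseSeq (suc (suc (suc zero))) fs gs) (π₄ v)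
IsUntil fs gs v = ∀ k → IsSup (untilSeq k fs gs) (π k v)

supBelow-cons : ∀ {F F′ : ℕ → Bool} → (∀ i → F (suc i) ≡ F′ i) →
  ∀ j → supBelow (suc j) F ≡ F 0 ∨ supBelow j F′
supBelow-cons {F} e zero    = sym (∨-identityʳ (F 0))
supBelow-cons {F} {F′} e (suc j) = begin
  supBelow (suc j) F ∨ F (suc j)     ≡⟨ cong₂ _∨_ (supBelow-cons e j) (e j) ⟩
  (F 0 ∨ supBelow j F′) ∨ F′ j       ≡⟨ ∨-assoc (F 0) (supBelow j F′) (F′ j) ⟩
  F 0 ∨ supBelow (suc j) F′          ∎

infBelow-cons : ∀ {F F′ : ℕ → Bool} → (∀ i → F (suc i) ≡ F′ i) →
  ∀ j → infBelow (suc j) F ≡ F 0 ∧ infBelow j F′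
infBelow-cons {F} e zero    = sym (∧-identityʳ (F 0))
infBelow-cons {F} {F′} e (suc j) = begin
  infBelow (suc j) F ∧ F (suc j)     ≡⟨ cong₂ _∧_ (infBelow-cons e j) (e j) ⟩
  (F 0 ∧ infBelow j F′) ∧ F′ j       ≡⟨ ∧-assoc (F 0) (infBelow j F′) (F′ j) ⟩
  F 0 ∧ infBelow (suc j) F′          ∎

module _ {fs gs fs′ gs′ : ℕ → B4}
         (tailφ : ∀ i → fs (suc i) ≡ fs′ i) (tailψ : ∀ i → gs (suc i) ≡ gs′ i) where

  releaseSeq-shift : ∀ k j → releaseSeq k fs gs (suc j) ≡ π k (fs 0) ∨ releaseSeq k fs′ gs′ j
  releaseSeq-shift k j = begin
    π k (gs (suc j)) ∨ supBelow (suc j) (λ i → π k (fs i))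
      ≡⟨ cong₂ _∨_ (cong (π k) (tailψ j)) (supBelow-cons (λ i → cong (π k) (tailφ i)) j) ⟩
    π k (gs′ j) ∨ (π k (fs 0) ∨ supBelow j (λ i → π k (fs′ i)))
      ≡⟨ ∨-Props.x∙yz≈y∙xz (π k (gs′ j)) (π k (fs 0)) _ ⟩
    π k (fs 0) ∨ releaseSeq k fs′ gs′ j ∎

  untilSeq-shift : ∀ k j → untilSeq k fs gs (suc j) ≡ π k (fs 0) ∧ untilSeq k fs′ gs′ j
  untilSeq-shift k j = begin
    π k (gs (suc j)) ∧ infBelow (suc j) (λ i → π k (fs i))
      ≡⟨ cong₂ _∧_ (cong (π k) (tailψ j)) (infBelow-cons (λ i → cong (π k) (tailφ i)) j) ⟩
    π k (gs′ j) ∧ (π k (fs 0) ∧ infBelow j (λ i → π k (fs′ i)))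
      ≡⟨ ∧-Props.x∙yz≈y∙xz (π k (gs′ j)) (π k (fs 0)) _ ⟩
    π k (fs 0) ∧ untilSeq k fs′ gs′ j ∎

-- The equations of the proposition, for the values a, b of φ, ψ at σ_{ℓ..}
-- and the values r, r′ (resp. u, u′) of φ Ṙ ψ (resp. φ U̇ ψ) at σ_{ℓ..}
-- and σ_{ℓ+1..}.
ReleaseUnfolding : B4 → B4 → B4 → B4 → Set
ReleaseUnfolding a b r r′ =
    (π₁ r ≡ (π₁ b ∧ (π₁ a ∨ π₁ r′)))
  × (π₂ r ≡ (π₁ r ∨ (π₂ a ∨ π₂ r′)))
  × (π₃ r ≡ (π₄ r ∧ (π₃ a ∨ π₃ r′)))
  × (π₄ r ≡ (π₄ b ∨ (π₄ a ∨ π₄ r′)))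

UntilUnfolding : B4 → B4 → B4 → B4 → Set
UntilUnfolding a b u u′ = (k : Fin 4) → π k u ≡ (π k b ∨ (π k a ∧ π k u′))

module _ {fs gs fs′ gs′ : ℕ → B4}
         (tailφ : ∀ i → fs (suc i) ≡ fs′ i) (tailψ : ∀ i → gs (suc i) ≡ gs′ i) where

  release-unfolding : ∀ {r r′} → IsRelease fs gs r → IsRelease fs′ gs′ r′ →
    ReleaseUnfolding (fs 0) (gs 0) r r′
  release-unfolding {r} {r′} (i₁ , i₂ , i₃ , i₄) (j₁ , j₂ , j₃ , j₄) = bit₁ , bit₂ , bit₃ , bit₄
    where
    shift : ∀ k j → releaseSeq k fs gs (suc j) ≡ π k (fs 0) ∨ releaseSeq k fs′ gs′ j
    shift = releaseSeq-shift {fs} {gs} tailφ tailψ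
    head : ∀ k → releaseSeq k fs gs 0 ≡ π k (gs 0)
    head k = ∨-identityʳ (π k (gs 0))
    bit₁ : π₁ r ≡ π₁ (gs 0) ∧ (π₁ (fs 0) ∨ π₁ r′)
    bit₁ = trans (inf-cons (shift zero) i₁ (inf-∨ˡ (π₁ (fs 0)) j₁))
                 (cong (_∧ (π₁ (fs 0) ∨ π₁ r′)) (head zero))
    -- the liminf ignores the head; π₁ r is absorbed because π₁ r ≤ π₂ r
    bit₂ : π₂ r ≡ π₁ r ∨ (π₂ (fs 0) ∨ π₂ r′)
    bit₂ = trans (∨-absorb-below (π₁ r) (π₂ r) (π₁⇒π₂ r))
                 (cong (π₁ r ∨_) (supInf-cons (shift (suc zero)) i₂ (supInf-∨ˡ (π₂ (fs 0)) j₂)))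
    -- the limsup ignores the head; π₄ r is absorbed because π₃ r ≤ π₄ r
    bit₃ : π₃ r ≡ π₄ r ∧ (π₃ (fs 0) ∨ π₃ r′)
    bit₃ = trans (∧-absorb-above (π₃ r) (π₄ r) (π₃⇒π₄ r))
                 (cong (π₄ r ∧_) (infSup-cons (shift (suc (suc zero))) i₃ (infSup-∨ˡ (π₃ (fs 0)) j₃)))
    bit₄ : π₄ r ≡ π₄ (gs 0) ∨ (π₄ (fs 0) ∨ π₄ r′)
    bit₄ = trans (sup-cons (shift (suc (suc (suc zero)))) i₄ (sup-∨ˡ (π₄ (fs 0)) j₄))
                 (cong (_∨ (π₄ (fs 0) ∨ π₄ r′)) (head (suc (suc (suc zero)))))

  until-unfolding : ∀ {u u′} → IsUntil fs gs u → IsUntil fs′ gs′ u′ →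
    UntilUnfolding (fs 0) (gs 0) u u′
  until-unfolding {u} {u′} h h′ k =
    trans (sup-cons (untilSeq-shift {fs} {gs} tailφ tailψ k) (h k) (sup-∧ˡ (π k (fs 0)) (h′ k)))
          (cong (_∨ (π k (fs 0) ∧ π k u′)) (∧-identityʳ (π k (gs 0))))

proposition3 : ∀ {n} (φ ψ : Formula n) (σ : Word n) (ℓ : ℕ) →
    (∀ {r r′ a b} →
      Val (σ ↑ ℓ) (φ Ṙ ψ) r → Val (σ ↑ suc ℓ) (φ Ṙ ψ) r′ →
      Val (σ ↑ ℓ) φ a → Val (σ ↑ ℓ) ψ b →
        (π₁ r ≡ (π₁ b ∧ (π₁ a ∨ π₁ r′)))
      × (π₂ r ≡ (π₁ r ∨ (π₂ a ∨ π₂ r′)))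
      × (π₃ r ≡ (π₄ r ∧ (π₃ a ∨ π₃ r′)))
      × (π₄ r ≡ (π₄ b ∨ (π₄ a ∨ π₄ r′))))
    × (∀ {u u′ a b} →
      Val (σ ↑ ℓ) (φ U̇ ψ) u → Val (σ ↑ suc ℓ) (φ U̇ ψ) u′ →
      Val (σ ↑ ℓ) φ a → Val (σ ↑ ℓ) ψ b →
      (k : Fin 4) → π k u ≡ (π k b ∨ (π k a ∧ π k u′)))
proposition3 φ ψ σ ℓ = release , until
  where
  tail : ∀ {χ : Formula _} {fs fs′ : ℕ → B4} → (∀ i → Val ((σ ↑ ℓ) ↑ i) χ (fs i)) →
    (∀ i → Val ((σ ↑ suc ℓ) ↑ i) χ (fs′ i)) → ∀ i → fs (suc i) ≡ fs′ i
  tail = suffixes-tail (σ ↑ ℓ) (σ ↑ suc ℓ) (↑-suc σ ℓ)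

  release : ∀ {r r′ a b} →
    Val (σ ↑ ℓ) (φ Ṙ ψ) r → Val (σ ↑ suc ℓ) (φ Ṙ ψ) r′ →
    Val (σ ↑ ℓ) φ a → Val (σ ↑ ℓ) ψ b → ReleaseUnfolding a b r r′
  release {r} {r′} (v-rel fs gs hf hg i₁ i₂ i₃ i₄) (v-rel fs′ gs′ hf′ hg′ j₁ j₂ j₃ j₄) va vb =
    subst₂ (λ a b → ReleaseUnfolding a b r r′) (suffixes-head (σ ↑ ℓ) hf va) (suffixes-head (σ ↑ ℓ) hg vb)
      (release-unfolding (tail hf hf′) (tail hg hg′)
                         (i₁ , i₂ , i₃ , i₄) (j₁ , j₂ , j₃ , j₄))

  until : ∀ {u u′ a b} →
    Val (σ ↑ ℓ) (φ U̇ ψ) u → Val (σ ↑ suc ℓ) (φ U̇ ψ) u′ →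
    Val (σ ↑ ℓ) φ a → Val (σ ↑ ℓ) ψ b → UntilUnfolding a b u u′
  until {u} {u′} (v-until fs gs hf hg h) (v-until fs′ gs′ hf′ hg′ h′) va vb =
    subst₂ (λ a b → UntilUnfolding a b u u′) (suffixes-head (σ ↑ ℓ) hf va) (suffixes-head (σ ↑ ℓ) hg vb)
      (until-unfolding (tail hf hf′) (tail hg hg′) h h′)
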